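{- There is no pair of positive integers $(x,y)$ such that both $\sqrt{x^2-xy+y^2}$ and $\sqrt{x^2+xy+y^2}$ are integers.
   Context: Interpretation: $x,y$ are the lengths of the two hands of a clock; at 2 o'clock the hands enclose the angle $\pi/3$ and at 4 o'clock the angle $2\pi/3$, so by the law of cosines the distances between the tips of the hands are $\sqrt{x^2-xy+y^2}$ and $\sqrt{x^2+xy+y^2}$ respectively. The statement says that no choice of $(x,y)$ makes both distances integers. -}

module Defs where

{-# OPTIONS --safe #-}
module Submission where

-- Multiplying the two equations gives (mn)² = x⁴ + x²y² + y⁴, so it suffices to show that this
-- quartic is never a square for positive x, y; we argue by descent on xy.  A common factor g > 1
-- of x and y divides out, since then g² divides the square root.  If x and y are coprime and both
-- odd, the quartic is 3 modulo 4.  Otherwise, say y = 2w, and z² + (xy)² = (x² + y²)² is a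
-- primitive Pythagorean triple, giving xw = PQ and x² + 4w² = P² + Q².  Writing x = βα, P = γα,
-- Q = δβ, w = γδ turns this into α²β² + 4γ²δ² = α²γ² + β²δ², that is
-- (δ² − α²)(β² − γ²) = 3γ²δ², and coprimality leaves four cases.  Two of them are impossible
-- modulo 4; in the other two a new primitive triple such as α² + (2γ)² = β² with δ² = α² + 3γ²
-- yields a solution whose product is γ or δ, a divisor of w and hence smaller than xy.

open import Defs
open import Data.Nat using (ℕ; _+_; _*_; _≥_)
open import Data.Product using (Σ; _×_)
open import Relation.Binary.PropositionalEquality using (_≡_)
open import Relation.Nullary using (¬_)

open import Data.Empty using (⊥; ⊥-elim)
open import Data.List using (_∷_; [])
open import Data.Nat using (zero; suc; _∸_; _≤_; _<_; _%_; _≤?_; z≤n; s≤s; ≢-nonZero)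
open import Data.Nat.Coprimality using (Coprime; coprime-divisor; coprime-factors; GCD≡1⇒coprime)
  renaming (sym to coprime-sym)
open import Data.Nat.DivMod using ([m+kn]%n≡m%n)
open import Data.Nat.Divisibility
open import Data.Nat.GCD
  using (GCD; gcd; gcd-GCD; GCD-*; gcd[m,n]∣m; gcd[m,n]∣n; gcd[m,n]≢0; gcd-greatest; c*gcd[m,n]≡gcd[cm,cn])
open import Data.Nat.Induction using (<-wellFounded)
open import Data.Nat.Primality using (Irreducible; irreducible?; irreducible[2]; euclidsLemma; prime[2])
open import Data.Nat.Properties
open import Data.Nat.Tactic.RingSolver using (solve)
open import Data.Product using (∃-syntax; _,_; map₂)
open import Data.Sum using (_⊎_; inj₁; inj₂; [_,_]′)
import Data.Sum as Sum
open import Induction.WellFounded using (Acc; acc)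
open import Relation.Binary.PropositionalEquality
  using (_≢_; refl; sym; trans; cong; cong₂; subst; subst₂; module ≡-Reasoning)
open import Relation.Nullary using (yes; no; contradiction)
open import Relation.Nullary.Decidable using (toWitness)

open ≡-Reasoning

variable
  a b c d f m n o p q t u : ℕ

*-≢0 : m ≢ 0 → n ≢ 0 → m * n ≢ 0
*-≢0 {m} m≢0 n≢0 mn≡0 = [ m≢0 , n≢0 ]′ (m*n≡0⇒m≡0∨n≡0 m mn≡0)

*-≢0ˡ : m * n ≢ 0 → m ≢ 0
*-≢0ˡ mn≢0 refl = mn≢0 refl

*-≢0ʳ : m * n ≢ 0 → n ≢ 0
*-≢0ʳ {m} mn≢0 refl = mn≢0 (*-zeroʳ m)

∣m+n∣n⇒∣m : d ∣ m + n → d ∣ n → d ∣ m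
∣m+n∣n⇒∣m {d} {m} {n} d∣m+n = ∣m+n∣m⇒∣n (subst (d ∣_) (+-comm m n) d∣m+n)

irreducible[3] : Irreducible 3
irreducible[3] = toWitness {a? = irreducible? 3} _

coprime-∣ˡ : Coprime m n → d ∣ m → Coprime d n
coprime-∣ˡ m⊥n d∣m (e∣d , e∣n) = m⊥n (∣-trans e∣d d∣m , e∣n)

coprime-*ʳ : Coprime m n → Coprime m o → Coprime m (n * o)
coprime-*ʳ m⊥n m⊥o (e∣m , e∣no) = m⊥o (e∣m , coprime-divisor (coprime-∣ˡ m⊥n e∣m) e∣no)

coprime-square : Coprime m n → Coprime (m * m) (n * n)
coprime-square m⊥n = coprime-sym (coprime-*ʳ n⊥m² n⊥m²)
  where n⊥m² = coprime-sym (coprime-*ʳ m⊥n m⊥n)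

odd⇒coprime-2 : ¬ 2 ∣ n → Coprime n 2
odd⇒coprime-2 2∤n (e∣n , e∣2) with irreducible[2] e∣2
... | inj₁ e≡1 = e≡1
... | inj₂ refl = contradiction e∣n 2∤n

coprime-*-sum-of-squares : Coprime m n → Coprime (m * n) (m * m + n * n)
coprime-*-sum-of-squares {m} {n} m⊥n {e} (e∣mn , e∣sum) = coprime-*ʳ e⊥m e⊥n (∣-refl , e∣mn)
  where
  e⊥m : Coprime e m
  e⊥m (k∣e , k∣m) = coprime-*ʳ m⊥n m⊥n (k∣m , ∣m+n∣m⇒∣n (∣-trans k∣e e∣sum) (∣m⇒∣m*n m k∣m))
  e⊥n : Coprime e n
  e⊥n (k∣e , k∣n) = coprime-*ʳ n⊥m n⊥m (k∣n , ∣m+n∣n⇒∣m (∣-trans k∣e e∣sum) (∣m⇒∣m*n n k∣n))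
    where n⊥m = coprime-sym m⊥n

pythagorean-coprime : a * a + b * b ≡ c * c → Coprime b c → Coprime a c
pythagorean-coprime {a} {b} {c} eq b⊥c {e} (e∣a , e∣c) = b⊥c (e∣b , e∣c)
  where
  e∣b² : e ∣ b * b
  e∣b² = ∣m+n∣m⇒∣n (subst (e ∣_) (sym eq) (∣m⇒∣m*n c e∣c)) (∣m⇒∣m*n a e∣a)
  e∣b : e ∣ b
  e∣b = coprime-divisor (coprime-∣ˡ (coprime-sym b⊥c) e∣c) e∣b²

pythagorean-odd-coprime : a * a + (2 * b) * (2 * b) ≡ c * c → Coprime c b → ¬ 2 ∣ a → Coprime a c
pythagorean-odd-coprime {a} {b} {c} eq c⊥b 2∤a {e} (e∣a , e∣c) = e⊥2b² (∣-refl , e∣2b²)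
  where
  e∣2b² : e ∣ (2 * b) * (2 * b)
  e∣2b² = ∣m+n∣m⇒∣n (subst (e ∣_) (sym eq) (∣m⇒∣m*n c e∣c)) (∣m⇒∣m*n a e∣a)
  e⊥2b : Coprime e (2 * b)
  e⊥2b = coprime-*ʳ (odd⇒coprime-2 (λ 2∣e → 2∤a (∣-trans 2∣e e∣a))) (coprime-∣ˡ c⊥b e∣c)
  e⊥2b² : Coprime e ((2 * b) * (2 * b))
  e⊥2b² = coprime-*ʳ e⊥2b e⊥2b

square-cancel-≤ : m * m ≤ n * n → m ≤ n
square-cancel-≤ {m} {n} m²≤n² with m ≤? n
... | yes m≤n = m≤n
... | no m≰n = contradiction m²≤n² (<⇒≱ (*-mono-< n<m n<m))
  where n<m = ≰⇒> m≰n

square-injective : m * m ≡ n * n → m ≡ n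
square-injective eq = ≤-antisym (square-cancel-≤ (≤-reflexive eq)) (square-cancel-≤ (≤-reflexive (sym eq)))

parity : ∀ n → (∃[ i ] n ≡ i * 2) ⊎ (∃[ i ] n ≡ 1 + i * 2)
parity zero = inj₁ (0 , refl)
parity (suc n) with parity n
... | inj₁ (i , n≡2i)   = inj₂ (i , cong suc n≡2i)
... | inj₂ (i , n≡1+2i) = inj₁ (suc i , cong suc n≡1+2i)

odd-square : ¬ 2 ∣ n → ∃[ o ] n * n ≡ 1 + o * 4
odd-square {n} 2∤n with parity n
... | inj₁ (i , n≡2i) = contradiction (divides i n≡2i) 2∤n
... | inj₂ (i , refl) = i + i * i , solve (i ∷ [])

residue-mod-4 : ∀ n o → m ≡ n + o * 4 → m % 4 ≡ n % 4
residue-mod-4 n o refl = [m+kn]%n≡m%n n o 4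

square-mod-4 : ∀ m n o → m * m ≡ n + o * 4 → n % 4 ≡ 0 ⊎ n % 4 ≡ 1
square-mod-4 m n o eq with parity m
... | inj₁ (i , refl) = inj₁ (trans (sym (residue-mod-4 n o eq)) (residue-mod-4 0 (i * i) even))
  where
  even : (i * 2) * (i * 2) ≡ 0 + (i * i) * 4
  even = solve (i ∷ [])
... | inj₂ (i , refl) = inj₂ (trans (sym (residue-mod-4 n o eq)) (residue-mod-4 1 (i + i * i) odd))
  where
  odd : (1 + i * 2) * (1 + i * 2) ≡ 1 + (i + i * i) * 4
  odd = solve (i ∷ [])

square≢2-mod-4 : ∀ m o → m * m ≢ 2 + o * 4
square≢2-mod-4 m o eq with square-mod-4 m 2 o eq
... | inj₁ ()
... | inj₂ ()

square≢3-mod-4 : ∀ m o → m * m ≢ 3 + o * 4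
square≢3-mod-4 m o eq with square-mod-4 m 3 o eq
... | inj₁ ()
... | inj₂ ()

odd⇒a²+b²≢square : ¬ 2 ∣ a → ¬ 2 ∣ b → a * a + b * b ≢ c * c
odd⇒a²+b²≢square {a} {b} {c} 2∤a 2∤b eq with odd-square 2∤a | odd-square 2∤b
... | i , a²≡1+4i | j , b²≡1+4j = square≢2-mod-4 c (i + j) (begin
  c * c                     ≡⟨ sym eq ⟩
  a * a + b * b             ≡⟨ cong₂ _+_ a²≡1+4i b²≡1+4j ⟩
  (1 + i * 4) + (1 + j * 4) ≡⟨ solve (i ∷ j ∷ []) ⟩
  2 + (i + j) * 4           ∎)

odd⇒square≢4n+3a² : ¬ 2 ∣ a → b * b ≢ 4 * n + 3 * (a * a)
odd⇒square≢4n+3a² {a} {b} {n} 2∤a eq with odd-square 2∤a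
... | i , a²≡1+4i = square≢3-mod-4 b (n + 3 * i) (begin
  b * b                     ≡⟨ eq ⟩
  4 * n + 3 * (a * a)       ≡⟨ cong (λ k → 4 * n + 3 * k) a²≡1+4i ⟩
  4 * n + 3 * (1 + i * 4)   ≡⟨ solve (n ∷ i ∷ []) ⟩
  3 + (n + 3 * i) * 4       ∎)

record CommonFactor (m n : ℕ) : Set where
  constructor commonFactor
  field
    g m′ n′ : ℕ
    m≡m′*g : m ≡ m′ * g
    n≡n′*g : n ≡ n′ * g
    coprime : Coprime m′ n′
    g≢0 : g ≢ 0

extract-gcd : ∀ m n → m ≢ 0 → CommonFactor m n
extract-gcd m n m≢0 = commonFactor (gcd m n) (quotient g∣m) (quotient g∣n) m≡ n≡ coprime g≢0
  where
  g∣m = gcd[m,n]∣m m n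
  g∣n = gcd[m,n]∣n m n
  m≡ = m∣n⇒n≡quotient*m g∣m
  n≡ = m∣n⇒n≡quotient*m g∣n
  g≢0 = gcd[m,n]≢0 m n (inj₁ m≢0)
  scaled : GCD (quotient g∣m * gcd m n) (quotient g∣n * gcd m n) (1 * gcd m n)
  scaled = subst₂ (λ i j → GCD i j (1 * gcd m n)) m≡ n≡
             (subst (GCD m n) (sym (*-identityˡ (gcd m n))) (gcd-GCD m n))
  coprime : Coprime (quotient g∣m) (quotient g∣n)
  coprime = GCD≡1⇒coprime (GCD-* {{≢-nonZero g≢0}} scaled)

square-∣⇒∣ : d * d ∣ a * a → d ∣ a
square-∣⇒∣ {zero} {a} 0∣a² with m*n≡0⇒m≡0∨n≡0 a (0∣⇒≡0 0∣a²)
... | inj₁ refl = ∣-refl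
... | inj₂ refl = ∣-refl
square-∣⇒∣ {d@(suc _)} {a} d²∣a² with extract-gcd d a (λ ())
... | commonFactor g d′ a′ d≡d′g a≡a′g d′⊥a′ g≢0 =
  subst₂ _∣_ (sym d≡d′g) (sym a≡a′g) (*-monoˡ-∣ g d′∣a′)
  where
  squares : ∀ {m} m′ → m ≡ m′ * g → m * m ≡ (m′ * m′) * (g * g)
  squares m′ refl = solve (m′ ∷ g ∷ [])
  d′²∣a′² : d′ * d′ ∣ a′ * a′
  d′²∣a′² = *-cancelʳ-∣ (g * g) {{≢-nonZero (*-≢0 g≢0 g≢0)}}
              (subst₂ _∣_ (squares d′ d≡d′g) (squares a′ a≡a′g) d²∣a²)
  d′∣a′ : d′ ∣ a′
  d′∣a′ = coprime-divisor d′⊥a′ (∣-trans (m∣m*n d′) d′²∣a′²)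

coprime-*-square⇒square : Coprime m n → m * n ≡ c * c → ∃[ r ] m ≡ r * r
coprime-*-square⇒square {m} {n} {c} m⊥n mn≡c² = r , ∣-antisym m∣r² r²∣m
  where
  r = gcd m c
  r∣c = gcd[m,n]∣n m c
  n⊥r : Coprime n r
  n⊥r = coprime-sym (coprime-∣ˡ m⊥n (gcd[m,n]∣m m c))
  r²∣m : r * r ∣ m
  r²∣m = coprime-divisor (coprime-sym (coprime-*ʳ n⊥r n⊥r))
           (subst (r * r ∣_) (trans (sym mn≡c²) (*-comm m n)) (*-pres-∣ r∣c r∣c))
  m∣rc : m ∣ r * c
  m∣rc = subst (m ∣_) (trans (sym (c*gcd[m,n]≡gcd[cm,cn] c m c)) (*-comm c r))
           (gcd-greatest (n∣m*n c) (subst (m ∣_) mn≡c² (m∣m*n n)))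
  m∣r² : m ∣ r * r
  m∣r² = subst (m ∣_) (sym (c*gcd[m,n]≡gcd[cm,cn] r m c)) (gcd-greatest (n∣m*n r) m∣rc)

FourNumberFactorisation : ℕ → ℕ → ℕ → ℕ → Set
FourNumberFactorisation m n p q =
  ∃[ α ] ∃[ β ] ∃[ γ ] ∃[ δ ] m ≡ β * α × p ≡ γ * α × q ≡ δ * β × n ≡ γ * δ × Coprime β γ

four-number-lemma : m ≢ 0 → m * n ≡ p * q → FourNumberFactorisation m n p q
four-number-lemma {m} {n} {p} {q} m≢0 mn≡pq with extract-gcd m p m≢0
... | commonFactor α β γ m≡βα p≡γα β⊥γ α≢0 =
  α , β , γ , quotient β∣q , m≡βα , p≡γα , q≡δβ , n≡γδ , β⊥γ
  where
  βn≡γq : β * n ≡ γ * q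
  βn≡γq = *-cancelˡ-≡ (β * n) (γ * q) α {{≢-nonZero α≢0}} (begin
    α * (β * n) ≡⟨ solve (α ∷ β ∷ n ∷ []) ⟩
    (β * α) * n ≡⟨ cong (_* n) (sym m≡βα) ⟩
    m * n       ≡⟨ mn≡pq ⟩
    p * q       ≡⟨ cong (_* q) p≡γα ⟩
    (γ * α) * q ≡⟨ solve (α ∷ γ ∷ q ∷ []) ⟩
    α * (γ * q) ∎)
  β∣q : β ∣ q
  β∣q = coprime-divisor β⊥γ (divides n (trans (sym βn≡γq) (*-comm β n)))
  q≡δβ = m∣n⇒n≡quotient*m β∣q
  n≡γδ : n ≡ γ * quotient β∣q
  n≡γδ = *-cancelˡ-≡ n _ β {{≢-nonZero (*-≢0ˡ (subst (_≢ 0) m≡βα m≢0))}} (begin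
    β * n                  ≡⟨ βn≡γq ⟩
    γ * q                  ≡⟨ cong (γ *_) q≡δβ ⟩
    γ * (quotient β∣q * β) ≡⟨ sym (*-assoc γ _ β) ⟩
    γ * quotient β∣q * β   ≡⟨ *-comm _ β ⟩
    β * (γ * quotient β∣q) ∎)

pythagorean-gap : a * a + (2 * b) * (2 * b) ≡ (a + f) * (a + f) → f * (2 * a + f) ≡ (2 * b) * (2 * b)
pythagorean-gap {a} {b} {f} eq = +-cancelˡ-≡ (a * a) _ _ (begin
  a * a + f * (2 * a + f)   ≡⟨ solve (a ∷ f ∷ []) ⟩
  (a + f) * (a + f)         ≡⟨ sym eq ⟩
  a * a + (2 * b) * (2 * b) ∎)

even-gap : f * (2 * a + f) ≡ (2 * b) * (2 * b) → 2 ∣ f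
even-gap {f} {a} {b} eq
  with euclidsLemma f (2 * a + f) prime[2] (subst (2 ∣_) (sym eq) (∣m⇒∣m*n (2 * b) (m∣m*n b)))
... | inj₁ 2∣f = 2∣f
... | inj₂ 2∣2a+f = ∣m+n∣m⇒∣n 2∣2a+f (m∣m*n a)

pythagorean-difference : a * a + (2 * b) * (2 * b) ≡ c * c → ∃[ e ] c ≡ a + 2 * e × e * (a + e) ≡ b * b
pythagorean-difference {a} {b} {c} eq
  with m≤n⇒∃[o]m+o≡n {a} {c} (square-cancel-≤ (subst (a * a ≤_) eq (m≤m+n (a * a) _)))
... | f , refl with even-gap {f} {a} {b} (pythagorean-gap {a} {b} {f} eq)
... | divides e refl = e , cong (a +_) (*-comm e 2) , *-cancelˡ-≡ _ _ 4 (begin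
  4 * (e * (a + e))         ≡⟨ solve (a ∷ e ∷ []) ⟩
  (e * 2) * (2 * a + e * 2) ≡⟨ pythagorean-gap {a} {b} {e * 2} eq ⟩
  (2 * b) * (2 * b)         ≡⟨ solve (b ∷ []) ⟩
  4 * (b * b)               ∎)

primitive-pythagorean-triple : a * a + (2 * b) * (2 * b) ≡ c * c → Coprime a c →
  ∃[ p ] ∃[ q ] a + q * q ≡ p * p × b ≡ p * q × c ≡ p * p + q * q
primitive-pythagorean-triple {a} {b} {c} eq a⊥c with pythagorean-difference {a} {b} {c} eq
... | e , refl , e[a+e]≡b² =
  parametrise (coprime-*-square⇒square {c = b} e⊥a+e e[a+e]≡b²)
              (coprime-*-square⇒square {c = b} (coprime-sym e⊥a+e) (trans (*-comm (a + e) e) e[a+e]≡b²))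
  where
  e⊥a+e : Coprime e (a + e)
  e⊥a+e (k∣e , k∣a+e) = a⊥c (k∣a , ∣m∣n⇒∣m+n k∣a (∣n⇒∣m*n 2 k∣e))
    where k∣a = ∣m+n∣n⇒∣m k∣a+e k∣e
  parametrise : ∃[ q ] e ≡ q * q → ∃[ p ] a + e ≡ p * p →
    ∃[ p ] ∃[ q ] a + q * q ≡ p * p × b ≡ p * q × a + 2 * e ≡ p * p + q * q
  parametrise (q , e≡q²) (p , a+e≡p²) = p , q , a+q²≡p² , b≡pq , c≡p²+q²
    where
    a+q²≡p² = trans (cong (a +_) (sym e≡q²)) a+e≡p²
    b≡pq = square-injective (begin
      b * b               ≡⟨ sym e[a+e]≡b² ⟩
      e * (a + e)         ≡⟨ cong₂ _*_ e≡q² a+e≡p² ⟩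
      (q * q) * (p * p)   ≡⟨ solve (p ∷ q ∷ []) ⟩
      (p * q) * (p * q)   ∎)
    c≡p²+q² = begin
      a + 2 * e       ≡⟨ solve (a ∷ e ∷ []) ⟩
      (a + e) + e     ≡⟨ cong₂ _+_ a+e≡p² e≡q² ⟩
      p * p + q * q   ∎

difference-of-multiples : m * o ≡ n * o + t → t ≢ 0 → ∃[ q ] m ≡ n + q × q * o ≡ t
difference-of-multiples {m} {o} {n} {t} eq t≢0 with n ≤? m
... | yes n≤m = m ∸ n , sym (m+[n∸m]≡n n≤m) , +-cancelˡ-≡ (n * o) _ _ (begin
  n * o + (m ∸ n) * o ≡⟨ sym (*-distribʳ-+ o n (m ∸ n)) ⟩
  (n + (m ∸ n)) * o   ≡⟨ cong (_* o) (m+[n∸m]≡n n≤m) ⟩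
  m * o               ≡⟨ eq ⟩
  n * o + t           ∎)
... | no n≰m = contradiction (n≤0⇒n≡0 (+-cancelˡ-≤ (n * o) t 0 no+t≤no)) t≢0
  where
  no+t≤no : n * o + t ≤ n * o + 0
  no+t≤no = subst₂ _≤_ eq (sym (+-identityʳ (n * o))) (*-monoˡ-≤ o (<⇒≤ (≰⇒> n≰m)))

coprime-cross-multiplication : q * p ≡ c * d → p ≢ 0 → Coprime p d → ∃[ o ] c ≡ o * p × q ≡ o * d
coprime-cross-multiplication {q} {p} {c} {d} eq p≢0 p⊥d
  with coprime-divisor p⊥d (divides q (trans (*-comm d c) (sym eq)))
... | divides o c≡op = o , c≡op , *-cancelʳ-≡ q (o * d) p {{≢-nonZero p≢0}} (begin
  q * p       ≡⟨ eq ⟩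
  c * d       ≡⟨ cong (_* d) c≡op ⟩
  o * p * d   ≡⟨ solve (o ∷ p ∷ d ∷ []) ⟩
  o * d * p   ∎)

factors-of-3cd : q * p ≡ (3 * c) * d → (3 * c) * d ≢ 0 → Coprime p d → Coprime q c →
  (p ≡ 3 * c × q ≡ d) ⊎ (p ≡ c × q ≡ 3 * d)
factors-of-3cd {q} {p} {c} {d} eq 3cd≢0 p⊥d q⊥c = split (coprime-cross-multiplication eq p≢0 p⊥d)
  where
  p≢0 : p ≢ 0
  p≢0 = *-≢0ʳ {q} (subst (_≢ 0) (sym eq) 3cd≢0)
  cofactor∣3 : ∀ {o} → 3 * c ≡ o * p → q ≡ o * d → o ∣ 3
  cofactor∣3 {o} 3c≡op q≡od = coprime-factors q⊥c
    (∣m⇒∣m*n 3 (subst (o ∣_) (sym q≡od) (m∣m*n d)) , subst (o ∣_) (trans (sym 3c≡op) (*-comm 3 c)) (m∣m*n p))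
  split : ∃[ o ] 3 * c ≡ o * p × q ≡ o * d → (p ≡ 3 * c × q ≡ d) ⊎ (p ≡ c × q ≡ 3 * d)
  split (o , 3c≡op , q≡od) with irreducible[3] {o} (cofactor∣3 3c≡op q≡od)
  ... | inj₁ refl = inj₁ (sym (trans 3c≡op (*-identityˡ p)) , trans q≡od (*-identityˡ d))
  ... | inj₂ refl = inj₂ (*-cancelˡ-≡ p c 3 (sym 3c≡op) , q≡od)

ab+4cd≡ac+bd-when-a≤d : d ≡ a + p → a * b + 4 * (c * d) ≡ a * c + b * d → (3 * c) * d ≢ 0 →
  Coprime a d → Coprime c b → (d ≡ a + 3 * c × b ≡ c + d) ⊎ (d ≡ a + c × b ≡ c + 3 * d)
ab+4cd≡ac+bd-when-a≤d {d} {a} {p} {b} {c} refl eq 3cd≢0 a⊥d c⊥b =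
  conclude (difference-of-multiples {b} {p} {c} [b-c]p≡3cd 3cd≢0)
  where
  [b-c]p≡3cd : b * p ≡ c * p + (3 * c) * (a + p)
  [b-c]p≡3cd = +-cancelˡ-≡ (a * b + a * c) _ _ (begin
    (a * b + a * c) + b * p                   ≡⟨ solve (a ∷ b ∷ c ∷ p ∷ []) ⟩
    a * c + b * (a + p)                       ≡⟨ sym eq ⟩
    a * b + 4 * (c * (a + p))                 ≡⟨ solve (a ∷ b ∷ c ∷ p ∷ []) ⟩
    (a * b + a * c) + (c * p + (3 * c) * (a + p)) ∎)
  conclude : ∃[ q ] b ≡ c + q × q * p ≡ (3 * c) * (a + p) →
    (a + p ≡ a + 3 * c × b ≡ c + (a + p)) ⊎ (a + p ≡ a + c × b ≡ c + 3 * (a + p))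
  conclude (q , b≡c+q , qp≡3cd) = Sum.map
    (λ (p≡3c , q≡d) → cong (a +_) p≡3c , trans b≡c+q (cong (c +_) q≡d))
    (λ (p≡c , q≡3d) → cong (a +_) p≡c , trans b≡c+q (cong (c +_) q≡3d))
    (factors-of-3cd qp≡3cd 3cd≢0 p⊥d q⊥c)
    where
    p⊥d : Coprime p (a + p)
    p⊥d (e∣p , e∣d) = a⊥d (∣m+n∣n⇒∣m e∣d e∣p , e∣d)
    q⊥c : Coprime q c
    q⊥c (e∣q , e∣c) = c⊥b (e∣c , subst (_ ∣_) (sym b≡c+q) (∣m∣n⇒∣m+n e∣c e∣q))

ab+4cd≡ac+bd-when-d≤a : a ≡ d + p → a * b + 4 * (c * d) ≡ a * c + b * d → (3 * c) * d ≢ 0 →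
  Coprime a d → Coprime c b → (a ≡ d + 3 * c × c ≡ b + d) ⊎ (a ≡ d + c × c ≡ b + 3 * d)
ab+4cd≡ac+bd-when-d≤a {a} {d} {p} {b} {c} refl eq 3cd≢0 a⊥d c⊥b =
  conclude (difference-of-multiples {c} {p} {b} [c-b]p≡3cd 3cd≢0)
  where
  [c-b]p≡3cd : c * p ≡ b * p + (3 * c) * d
  [c-b]p≡3cd = +-cancelˡ-≡ (d * b + d * c) _ _ (begin
    (d * b + d * c) + c * p                   ≡⟨ solve (b ∷ c ∷ d ∷ p ∷ []) ⟩
    (d + p) * c + b * d                       ≡⟨ sym eq ⟩
    (d + p) * b + 4 * (c * d)                 ≡⟨ solve (b ∷ c ∷ d ∷ p ∷ []) ⟩
    (d * b + d * c) + (b * p + (3 * c) * d)   ∎)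
  conclude : ∃[ q ] c ≡ b + q × q * p ≡ (3 * c) * d →
    (d + p ≡ d + 3 * c × c ≡ b + d) ⊎ (d + p ≡ d + c × c ≡ b + 3 * d)
  conclude (q , c≡b+q , qp≡3cd) = Sum.map
    (λ (p≡3c , q≡d) → cong (d +_) p≡3c , trans c≡b+q (cong (b +_) q≡d))
    (λ (p≡c , q≡3d) → cong (d +_) p≡c , trans c≡b+q (cong (b +_) q≡3d))
    (factors-of-3cd qp≡3cd 3cd≢0 p⊥d q⊥c)
    where
    p⊥d : Coprime p d
    p⊥d (e∣p , e∣d) = a⊥d (∣m∣n⇒∣m+n e∣d e∣p , e∣d)
    q⊥c : Coprime q c
    q⊥c (e∣q , e∣c) = c⊥b (e∣c , ∣m+n∣n⇒∣m (subst (_ ∣_) c≡b+q e∣c) e∣q)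

ab+4cd≡ac+bd-cases : a * b + 4 * (c * d) ≡ a * c + b * d → (3 * c) * d ≢ 0 → Coprime a d → Coprime c b →
  ((d ≡ a + 3 * c × b ≡ c + d) ⊎ (d ≡ a + c × b ≡ c + 3 * d)) ⊎
  ((a ≡ d + 3 * c × c ≡ b + d) ⊎ (a ≡ d + c × c ≡ b + 3 * d))
ab+4cd≡ac+bd-cases {a} {b} {c} {d} eq 3cd≢0 a⊥d c⊥b = Sum.map
  (λ a≤d → ab+4cd≡ac+bd-when-a≤d (sym (m+[n∸m]≡n a≤d)) eq 3cd≢0 a⊥d c⊥b)
  (λ d≤a → ab+4cd≡ac+bd-when-d≤a (sym (m+[n∸m]≡n d≤a)) eq 3cd≢0 a⊥d c⊥b)
  (≤-total a d)

quadraticForm : ℕ → ℕ → ℕ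
quadraticForm a b = a * a + a * b + b * b

quartic : ℕ → ℕ → ℕ
quartic x y = quadraticForm (x * x) (y * y)

record Solution : Set where
  constructor solution
  field
    x y z : ℕ
    xy≢0 : x * y ≢ 0
    z²≡quartic : z * z ≡ quartic x y

size : Solution → ℕ
size s = Solution.x s * Solution.y s

quartic-pythagorean : ∀ {x y z} → z * z ≡ quartic x y →
  z * z + (x * y) * (x * y) ≡ (x * x + y * y) * (x * x + y * y)
quartic-pythagorean {x} {y} {z} eq = begin
  z * z + (x * y) * (x * y)                                        ≡⟨ cong (_+ (x * y) * (x * y)) eq ⟩
  (x * x) * (x * x) + (x * x) * (y * y) + (y * y) * (y * y) + (x * y) * (x * y) ≡⟨ solve (x ∷ y ∷ []) ⟩
  (x * x + y * y) * (x * x + y * y)                                ∎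

quartic-comm : ∀ x y → quartic x y ≡ quartic y x
quartic-comm x y = begin
  (x * x) * (x * x) + (x * x) * (y * y) + (y * y) * (y * y) ≡⟨ solve (x ∷ y ∷ []) ⟩
  (y * y) * (y * y) + (y * y) * (x * x) + (x * x) * (x * x) ∎

quartic-scale : ∀ x y g → quartic (x * g) (y * g) ≡ quartic x y * ((g * g) * (g * g))
quartic-scale x y g = begin
  ((x * g) * (x * g)) * ((x * g) * (x * g)) + ((x * g) * (x * g)) * ((y * g) * (y * g))
    + ((y * g) * (y * g)) * ((y * g) * (y * g))                ≡⟨ solve (x ∷ y ∷ g ∷ []) ⟩
  ((x * x) * (x * x) + (x * x) * (y * y) + (y * y) * (y * y)) * ((g * g) * (g * g)) ∎

odd-quartic-not-square : ∀ {x y z} → ¬ 2 ∣ x → ¬ 2 ∣ y → z * z ≢ quartic x y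
odd-quartic-not-square {x} {y} {z} 2∤x 2∤y eq with odd-square 2∤x | odd-square 2∤y
... | i , x²≡1+4i | j , y²≡1+4j =
  square≢3-mod-4 z (3 * i + 3 * j + 4 * (i * i) + 4 * (i * j) + 4 * (j * j)) (begin
    z * z                                                         ≡⟨ eq ⟩
    quartic x y                                                   ≡⟨ cong₂ quadraticForm x²≡1+4i y²≡1+4j ⟩
    (1 + i * 4) * (1 + i * 4) + (1 + i * 4) * (1 + j * 4) + (1 + j * 4) * (1 + j * 4)
                                                                  ≡⟨ solve (i ∷ j ∷ []) ⟩
    3 + (3 * i + 3 * j + 4 * (i * i) + 4 * (i * j) + 4 * (j * j)) * 4 ∎)

solution-from-pythagorean : a * a + (2 * b) * (2 * b) ≡ c * c → Coprime a c → u * u ≡ a * a + 3 * (b * b) →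
  b ≢ 0 → Σ Solution λ s → size s ≡ b
solution-from-pythagorean {a} {b} {c} {u} eq a⊥c u²≡ b≢0
  with primitive-pythagorean-triple {a} {b} {c} eq a⊥c
... | p , q , a+q²≡p² , refl , _ = solution p q u b≢0 u²≡quartic , refl
  where
  u²≡quartic : u * u ≡ quartic p q
  u²≡quartic = begin
    u * u                                  ≡⟨ u²≡ ⟩
    a * a + 3 * ((p * q) * (p * q))        ≡⟨ solve (a ∷ p ∷ q ∷ []) ⟩
    a * a + 3 * ((p * p) * (q * q))        ≡⟨ cong (λ k → a * a + 3 * (k * (q * q))) (sym a+q²≡p²) ⟩
    a * a + 3 * ((a + q * q) * (q * q))    ≡⟨ solve (a ∷ q ∷ []) ⟩
    (a + q * q) * (a + q * q) + (a + q * q) * (q * q) + (q * q) * (q * q)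
                                           ≡⟨ cong (λ k → quadraticForm k (q * q)) a+q²≡p² ⟩
    quartic p q                            ∎

even-leg-parametrisation : ∀ {x w z} → Coprime x (2 * w) → z * z ≡ quartic x (2 * w) →
  ∃[ p ] ∃[ q ] x * w ≡ p * q × x * x + (2 * w) * (2 * w) ≡ p * p + q * q
even-leg-parametrisation {x} {w} {z} x⊥2w eq = parametrise (primitive-pythagorean-triple {z} {x * w} pyth z⊥x²+4w²)
  where
  pyth′ = quartic-pythagorean {x} {2 * w} {z} eq
  z⊥x²+4w² = pythagorean-coprime pyth′ (coprime-*-sum-of-squares x⊥2w)
  pyth : z * z + (2 * (x * w)) * (2 * (x * w)) ≡ (x * x + (2 * w) * (2 * w)) * (x * x + (2 * w) * (2 * w))
  pyth = trans (cong (λ k → z * z + k * k) 2xw≡x2w) pyth′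
    where
    2xw≡x2w : 2 * (x * w) ≡ x * (2 * w)
    2xw≡x2w = solve (x ∷ w ∷ [])
  parametrise : ∃[ p ] ∃[ q ] z + q * q ≡ p * p × x * w ≡ p * q × x * x + (2 * w) * (2 * w) ≡ p * p + q * q →
    ∃[ p ] ∃[ q ] x * w ≡ p * q × x * x + (2 * w) * (2 * w) ≡ p * p + q * q
  parametrise (p , q , _ , xw≡pq , x²+4w²≡p²+q²) = p , q , xw≡pq , x²+4w²≡p²+q²

smaller-solution : ∀ {α β γ δ} → ¬ 2 ∣ α → ¬ 2 ∣ β → Coprime α δ → Coprime β γ → γ * δ ≢ 0 →
  (α * α) * (β * β) + 4 * ((γ * γ) * (δ * δ)) ≡ (α * α) * (γ * γ) + (β * β) * (δ * δ) →
  Σ Solution λ s → size s ∣ γ * δ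
smaller-solution {α} {β} {γ} {δ} 2∤α 2∤β α⊥δ β⊥γ γδ≢0 eq =
  resolve (ab+4cd≡ac+bd-cases eq 3γ²δ²≢0 (coprime-square α⊥δ) (coprime-square (coprime-sym β⊥γ)))
  where
  γ≢0 = *-≢0ˡ {γ} {δ} γδ≢0
  δ≢0 = *-≢0ʳ {γ} {δ} γδ≢0
  3γ²δ²≢0 : (3 * (γ * γ)) * (δ * δ) ≢ 0
  3γ²δ²≢0 = *-≢0 (*-≢0 {3} (λ ()) (*-≢0 γ≢0 γ≢0)) (*-≢0 δ≢0 δ≢0)
  resolve : ((δ * δ ≡ α * α + 3 * (γ * γ) × β * β ≡ γ * γ + δ * δ) ⊎
             (δ * δ ≡ α * α + γ * γ × β * β ≡ γ * γ + 3 * (δ * δ))) ⊎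
            ((α * α ≡ δ * δ + 3 * (γ * γ) × γ * γ ≡ β * β + δ * δ) ⊎
             (α * α ≡ δ * δ + γ * γ × γ * γ ≡ β * β + 3 * (δ * δ))) →
            Σ Solution λ s → size s ∣ γ * δ
  resolve (inj₁ (inj₁ (δ²≡α²+3γ² , β²≡γ²+δ²))) =
    map₂ (λ size≡γ → subst (_∣ γ * δ) (sym size≡γ) (m∣m*n δ))
      (solution-from-pythagorean {α} {γ} {β} {δ} pyth α⊥β δ²≡α²+3γ² γ≢0)
    where
    pyth : α * α + (2 * γ) * (2 * γ) ≡ β * β
    pyth = begin
      α * α + (2 * γ) * (2 * γ)       ≡⟨ solve (α ∷ γ ∷ []) ⟩
      γ * γ + (α * α + 3 * (γ * γ))   ≡⟨ cong (γ * γ +_) (sym δ²≡α²+3γ²) ⟩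
      γ * γ + δ * δ                   ≡⟨ sym β²≡γ²+δ² ⟩
      β * β                           ∎
    α⊥β = pythagorean-odd-coprime pyth β⊥γ 2∤α
  resolve (inj₁ (inj₂ (δ²≡α²+γ² , β²≡γ²+3δ²))) =
    ⊥-elim (odd⇒square≢4n+3a² {α} {β} {γ * γ} 2∤α (begin
    β * β                         ≡⟨ β²≡γ²+3δ² ⟩
    γ * γ + 3 * (δ * δ)           ≡⟨ cong (λ k → γ * γ + 3 * k) δ²≡α²+γ² ⟩
    γ * γ + 3 * (α * α + γ * γ)   ≡⟨ solve (α ∷ γ ∷ []) ⟩
    4 * (γ * γ) + 3 * (α * α)     ∎))
  resolve (inj₂ (inj₁ (α²≡δ²+3γ² , γ²≡β²+δ²))) =
    ⊥-elim (odd⇒a²+b²≢square {α} {β} {2 * γ} 2∤α 2∤β (begin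
    α * α + β * β                 ≡⟨ cong (_+ β * β) α²≡δ²+3γ² ⟩
    δ * δ + 3 * (γ * γ) + β * β   ≡⟨ solve (β ∷ γ ∷ δ ∷ []) ⟩
    (β * β + δ * δ) + 3 * (γ * γ) ≡⟨ cong (_+ 3 * (γ * γ)) (sym γ²≡β²+δ²) ⟩
    γ * γ + 3 * (γ * γ)           ≡⟨ solve (γ ∷ []) ⟩
    (2 * γ) * (2 * γ)             ∎))
  resolve (inj₂ (inj₂ (α²≡δ²+γ² , γ²≡β²+3δ²))) =
    map₂ (λ size≡δ → subst (_∣ γ * δ) (sym size≡δ) (n∣m*n γ))
      (solution-from-pythagorean {β} {δ} {α} {γ} pyth β⊥α γ²≡β²+3δ² δ≢0)
    where
    pyth : β * β + (2 * δ) * (2 * δ) ≡ α * α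
    pyth = begin
      β * β + (2 * δ) * (2 * δ)       ≡⟨ solve (β ∷ δ ∷ []) ⟩
      δ * δ + (β * β + 3 * (δ * δ))   ≡⟨ cong (δ * δ +_) (sym γ²≡β²+3δ²) ⟩
      δ * δ + γ * γ                   ≡⟨ sym α²≡δ²+γ² ⟩
      α * α                           ∎
    β⊥α = pythagorean-odd-coprime pyth α⊥δ 2∤β

m∣n⇒m<o*[2*n] : m ∣ n → n ≢ 0 → o ≢ 0 → m < o * (2 * n)
m∣n⇒m<o*[2*n] {m} {n} {o} m∣n n≢0 o≢0 =
  ≤-<-trans (∣⇒≤ {{≢-nonZero n≢0}} m∣n) (<-≤-trans n<2n (m≤n*m (2 * n) o {{≢-nonZero o≢0}}))
  where
  n<2n : n < 2 * n
  n<2n = subst (n <_) (*-comm n 2) (m<m*n n 2 {{≢-nonZero n≢0}} (s≤s (s≤s z≤n)))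

-- The factorisation is matched as an argument rather than through `with`: abstracting over
-- the lemma call would make Agda normalise its proof, which exhausts memory.
descent-from-factorisation : ∀ {x w p q} → FourNumberFactorisation x w p q →
  x * (2 * w) ≢ 0 → Coprime x (2 * w) → x * x + (2 * w) * (2 * w) ≡ p * p + q * q →
  Σ Solution λ s → size s < x * (2 * w)
descent-from-factorisation (α , β , γ , δ , refl , refl , refl , refl , β⊥γ) xy≢0 x⊥2w x²+4w²≡p²+q² =
  map₂ (λ s∣w → m∣n⇒m<o*[2*n] s∣w γδ≢0 (*-≢0ˡ {β * α} xy≢0))
    (smaller-solution 2∤α 2∤β α⊥δ β⊥γ γδ≢0 βα²+4γδ²)
  where
  γδ≢0 : γ * δ ≢ 0
  γδ≢0 = *-≢0ʳ {2} (*-≢0ʳ {β * α} xy≢0)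
  2∤x : ¬ 2 ∣ β * α
  2∤x 2∣x with x⊥2w (2∣x , m∣m*n (γ * δ))
  ... | ()
  2∤α : ¬ 2 ∣ α
  2∤α 2∣α = 2∤x (∣n⇒∣m*n β 2∣α)
  2∤β : ¬ 2 ∣ β
  2∤β 2∣β = 2∤x (∣m⇒∣m*n α 2∣β)
  α⊥δ : Coprime α δ
  α⊥δ (e∣α , e∣δ) = x⊥2w (∣-trans e∣α (n∣m*n β) , ∣-trans e∣δ (∣n⇒∣m*n 2 (n∣m*n γ)))
  βα²+4γδ² : (α * α) * (β * β) + 4 * ((γ * γ) * (δ * δ)) ≡ (α * α) * (γ * γ) + (β * β) * (δ * δ)
  βα²+4γδ² = begin
    (α * α) * (β * β) + 4 * ((γ * γ) * (δ * δ))           ≡⟨ solve (α ∷ β ∷ γ ∷ δ ∷ []) ⟩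
    (β * α) * (β * α) + (2 * (γ * δ)) * (2 * (γ * δ))     ≡⟨ x²+4w²≡p²+q² ⟩
    (γ * α) * (γ * α) + (δ * β) * (δ * β)                 ≡⟨ solve (α ∷ β ∷ γ ∷ δ ∷ []) ⟩
    (α * α) * (γ * γ) + (β * β) * (δ * δ)                 ∎

even-descent : ∀ {x y z w} → x * y ≢ 0 → y ≡ 2 * w → Coprime x y → z * z ≡ quartic x y →
  Σ Solution λ s → size s < x * y
even-descent {x} {_} {z} {w} xy≢0 refl x⊥2w eq =
  let p , q , xw≡pq , x²+4w²≡p²+q² = even-leg-parametrisation {x} {w} {z} x⊥2w eq
  in descent-from-factorisation {x} {w} {p} {q} (four-number-lemma (*-≢0ˡ {x} xy≢0) xw≡pq)
       xy≢0 x⊥2w x²+4w²≡p²+q²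

coprime-descent : ∀ {x y z} → x * y ≢ 0 → Coprime x y → z * z ≡ quartic x y → Σ Solution λ s → size s < x * y
coprime-descent {x} {y} {z} xy≢0 x⊥y eq with 2 ∣? x | 2 ∣? y
... | _ | yes (divides w y≡w2) = even-descent {x} {y} {z} {w} xy≢0 (trans y≡w2 (*-comm w 2)) x⊥y eq
... | yes (divides w x≡w2) | no _ =
  map₂ (λ {s} → subst (size s <_) (*-comm y x))
    (even-descent {y} {x} {z} {w} (subst (_≢ 0) (*-comm x y) xy≢0) (trans x≡w2 (*-comm w 2))
      (coprime-sym x⊥y) (trans eq (quartic-comm x y)))
... | no 2∤x | no 2∤y = ⊥-elim (odd-quartic-not-square {x} {y} {z} 2∤x 2∤y eq)

scaling-descent : ∀ {x y z x′ y′ g} → x ≡ x′ * g → y ≡ y′ * g → 1 < g → x * y ≢ 0 → z * z ≡ quartic x y →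
  Σ Solution λ s → size s < x * y
scaling-descent {_} {_} {z} {x′} {y′} {g} refl refl 1<g xy≢0 eq
  with square-∣⇒∣ {g * g} {z} (divides (quartic x′ y′) (trans eq (quartic-scale x′ y′ g)))
... | divides z′ refl =
  solution x′ y′ z′ x′y′≢0 z′²≡quartic , subst (x′ * y′ <_) (sym xy≡x′y′g²) x′y′<x′y′g²
  where
  g≢0 = m<n⇒n≢0 1<g
  g⁴≢0 = *-≢0 (*-≢0 g≢0 g≢0) (*-≢0 g≢0 g≢0)
  xy≡x′y′g² : (x′ * g) * (y′ * g) ≡ (x′ * y′) * (g * g)
  xy≡x′y′g² = solve (x′ ∷ y′ ∷ g ∷ [])
  x′y′≢0 : x′ * y′ ≢ 0
  x′y′≢0 x′y′≡0 = xy≢0 (trans xy≡x′y′g² (cong (_* (g * g)) x′y′≡0))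
  x′y′<x′y′g² : x′ * y′ < (x′ * y′) * (g * g)
  x′y′<x′y′g² = m<m*n (x′ * y′) (g * g) {{≢-nonZero x′y′≢0}} (<-≤-trans 1<g (m≤m*n g g {{≢-nonZero g≢0}}))
  z′²≡quartic : z′ * z′ ≡ quartic x′ y′
  z′²≡quartic = *-cancelʳ-≡ _ _ ((g * g) * (g * g)) {{≢-nonZero g⁴≢0}} (begin
    (z′ * z′) * ((g * g) * (g * g))   ≡⟨ solve (z′ ∷ g ∷ []) ⟩
    (z′ * (g * g)) * (z′ * (g * g))   ≡⟨ eq ⟩
    quartic (x′ * g) (y′ * g)         ≡⟨ quartic-scale x′ y′ g ⟩
    quartic x′ y′ * ((g * g) * (g * g)) ∎)

descent : (s : Solution) → Σ Solution λ t → size t < size s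
descent (solution x y z xy≢0 eq) with extract-gcd x y (*-≢0ˡ {x} xy≢0)
... | commonFactor 0 _ _ _ _ _ g≢0 = contradiction refl g≢0
... | commonFactor 1 x′ y′ x≡x′1 y≡y′1 x′⊥y′ _ =
  coprime-descent {x} {y} {z} xy≢0
    (subst₂ Coprime (sym (trans x≡x′1 (*-identityʳ x′))) (sym (trans y≡y′1 (*-identityʳ y′))) x′⊥y′) eq
... | commonFactor g@(suc (suc _)) x′ y′ x≡x′g y≡y′g _ _ =
  scaling-descent {x} {y} {z} {x′} {y′} {g} x≡x′g y≡y′g (s≤s (s≤s z≤n)) xy≢0 eq

no-solution : Solution → ⊥
no-solution s = go s (<-wellFounded (size s))
  where
  go : (s : Solution) → Acc _<_ (size s) → ⊥
  go s (acc smaller) with descent s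
  ... | t , t<s = go t (smaller t<s)

[mn]²≡quartic : ∀ {x y m n} → m * m + x * y ≡ x * x + y * y → n * n ≡ quadraticForm x y →
  (m * n) * (m * n) ≡ quartic x y
[mn]²≡quartic {x} {y} {m} {n} m²≡ n²≡ = +-cancelʳ-≡ ((x * y) * (n * n)) _ _ (begin
  (m * n) * (m * n) + (x * y) * (n * n)              ≡⟨ solve (m ∷ n ∷ x ∷ y ∷ []) ⟩
  (m * m + x * y) * (n * n)                          ≡⟨ cong₂ _*_ m²≡ n²≡ ⟩
  (x * x + y * y) * (x * x + x * y + y * y)          ≡⟨ solve (x ∷ y ∷ []) ⟩
  (x * x) * (x * x) + (x * x) * (y * y) + (y * y) * (y * y) + (x * y) * (x * x + x * y + y * y)
                                                     ≡⟨ cong (λ k → quartic x y + (x * y) * k) (sym n²≡) ⟩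
  quartic x y + (x * y) * (n * n)                    ∎)

mainTheorem3 : (x y : ℕ) → x ≥ 1 → y ≥ 1 →
    ¬ (Σ ℕ λ m → Σ ℕ λ n →
    (m * m + x * y ≡ x * x + y * y) × (n * n ≡ x * x + x * y + y * y))
mainTheorem3 x y x≥1 y≥1 (m , n , m²+xy≡x²+y² , n²≡x²+xy+y²) =
  no-solution (solution x y (m * n) (n>0⇒n≢0 (*-mono-≤ x≥1 y≥1))
                ([mn]²≡quartic {x} {y} {m} {n} m²+xy≡x²+y² n²≡x²+xy+y²))
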